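{- Let $n\ge 3$ be an even integer and let $\mathcal{F}$ be a 1-factorisation of $Circ(2n,\{1,2\})$. Then at least one 1-factor of $\mathcal{F}$ consists entirely of 1-edges.
   Context: For a positive integer $N$ and $D\subseteq\{1,\dots,\lfloor N/2\rfloor\}$, the circulant graph $Circ(N,D)$ has vertex set $\mathbb{Z}_N$, with $u,v$ adjacent iff $u-v\equiv \pm d \pmod N$ for some $d\in D$. A 1-factor is a 1-regular spanning subgraph; a 1-factorisation is a partition of the edge set into 1-factors. In $Circ(2n,\{1,2\})$ (arithmetic mod $2n$), a 1-edge is an edge of the form $\{v,v+1\}$. -}

module Defs where

open import Level using (0ℓ)
open import Data.Nat using (ℕ; _+_; _*_)
open import Data.Nat.Divisibility using (_∣_)
open import Data.Fin using (Fin; toℕ)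
open import Data.Product using (Σ; ∃; _×_; _,_)
open import Data.Sum using (_⊎_)
open import Relation.Binary.PropositionalEquality using (_≡_)

Graph : ℕ → Set₁
Graph N = Fin N → Fin N → Set

-- Step N d u v  :  v ≡ u + d (mod N).
-- Since u, v < N and the distances used satisfy d ≤ N/2 < N, the congruence
-- holds iff u + d = v or u + d = v + N.
Step : (N : ℕ) → ℕ → Fin N → Fin N → Set
Step N d u v = (toℕ u + d ≡ toℕ v) ⊎ (toℕ u + d ≡ toℕ v + N)

-- Circulant graph Circ(N, D), with the connection set D given as a predicate on ℕ
-- (intended to be a subset of {1, …, ⌊N/2⌋}):
-- u ~ v  iff  u - v ≡ ± d (mod N) for some d ∈ D.
Circ : (N : ℕ) → (ℕ → Set) → Graph N
Circ N D u v = Σ ℕ λ d → D d × (Step N d u v ⊎ Step N d v u)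

D12 : ℕ → Set
D12 d = (d ≡ 1) ⊎ (d ≡ 2)

IsOneFactor : {N : ℕ} → Graph N → Graph N → Set
IsOneFactor {N} G H =
  (∀ u v → H u v → H v u) ×
  (∀ u v → H u v → G u v) ×
  (∀ u → Σ (Fin N) λ v → H u v × (∀ w → H u w → w ≡ v))

record OneFactorisation {N : ℕ} (G : Graph N) : Set₁ where
  field
    k        : ℕ
    factor   : Fin k → Graph N
    isFactor : ∀ i → IsOneFactor G (factor i)
    partition : ∀ u v → G u v →
                Σ (Fin k) λ i → factor i u v × (∀ j → factor j u v → j ≡ i)

IsOneEdge : (N : ℕ) → Fin N → Fin N → Set
IsOneEdge N u v = Step N 1 u v ⊎ Step N 1 v u

-- Call 2-edges {s, s+2} and {s+1, s+3} lying in a common 1-factor a parallel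
-- pair at s. Inspecting the mate of s+2 in the factor of {s+1, s+3} shows that
-- this factor also contains {s, s+2} or {s+2, s+4}; hence parallel pairs exist,
-- and one at s forces one at s+2. Given parallel pairs at s+1, s+3, ..., the
-- factor of the 1-edge {s+1, s+2} must contain {s+3, s+4}, {s+5, s+6}, ...,
-- which cover every vertex, so that factor consists of 1-edges only.
module Submission where

open import Defs
open import Data.Nat using (ℕ; zero; suc; _+_; _*_; _∸_; _≤_; _<_; z≤n; s≤s; s≤s⁻¹; NonZero; >-nonZero; >-nonZero⁻¹)
open import Data.Nat.Divisibility using (_∣_)
open import Data.Nat.DivMod using (_%_; _/_; _mod_; m%n<n; m<n⇒m%n≡m; [m+kn]%n≡m%n; m≡m%n+[m/n]*n; m<n*o⇒m/o<n)
open import Data.Nat.Properties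
open import Algebra.Properties.CommutativeSemigroup +-commutativeSemigroup using (xy∙z≈xz∙y)
open import Data.Fin using (Fin; toℕ)
open import Data.Fin.Properties using (toℕ-fromℕ<; toℕ-injective; toℕ<n)
open import Data.Product using (Σ; ∃-syntax; _×_; _,_)
open import Data.Sum using (_⊎_; inj₁; inj₂; swap)
open import Data.Empty using (⊥; ⊥-elim)
open import Relation.Nullary using (¬_)
open import Relation.Binary.PropositionalEquality

iterate-+2 : ∀ (P : ℕ → Set) → (∀ {a} → P a → P (2 + a)) → ∀ {a} → P a → ∀ q → P (q * 2 + a)
iterate-+2 P step p zero    = p
iterate-+2 P step p (suc q) = step (iterate-+2 P step p q)

module _ {N : ℕ} .{{_ : NonZero N}} where

  toℕ-mod : ∀ x → toℕ (x mod N) ≡ x % N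
  toℕ-mod x = toℕ-fromℕ< (m%n<n x N)

  toℕ-mod-inverse : ∀ (u : Fin N) → toℕ u mod N ≡ u
  toℕ-mod-inverse u = toℕ-injective (trans (toℕ-mod (toℕ u)) (m<n⇒m%n≡m (toℕ<n u)))

  mod-periodic : ∀ x k → (x + k * N) mod N ≡ x mod N
  mod-periodic x k = toℕ-injective (begin
    toℕ ((x + k * N) mod N) ≡⟨ toℕ-mod (x + k * N) ⟩
    (x + k * N) % N         ≡⟨ [m+kn]%n≡m%n x k N ⟩
    x % N                   ≡⟨ toℕ-mod x ⟨
    toℕ (x mod N)           ∎)
    where open ≡-Reasoning

  [m%n+d]%n≡[d+m]%n : ∀ x d → (x % N + d) % N ≡ (d + x) % N
  [m%n+d]%n≡[d+m]%n x d = begin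
    (x % N + d) % N                 ≡⟨ cong (_% N) (+-comm (x % N) d) ⟩
    (d + x % N) % N                 ≡⟨ [m+kn]%n≡m%n (d + x % N) (x / N) N ⟨
    (d + x % N + x / N * N) % N     ≡⟨ cong (_% N) (+-assoc d (x % N) (x / N * N)) ⟩
    (d + (x % N + x / N * N)) % N   ≡⟨ cong (λ t → (d + t) % N) (m≡m%n+[m/n]*n x N) ⟨
    (d + x) % N                     ∎
    where open ≡-Reasoning

  remainder-unique : ∀ {a b} i j → a < N → b < N → a + i * N ≡ b + j * N → a ≡ b
  remainder-unique {a} {b} i j a<N b<N eq = begin
    a               ≡⟨ m<n⇒m%n≡m a<N ⟨
    a % N           ≡⟨ [m+kn]%n≡m%n a i N ⟨
    (a + i * N) % N ≡⟨ cong (_% N) eq ⟩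
    (b + j * N) % N ≡⟨ [m+kn]%n≡m%n b j N ⟩
    b % N           ≡⟨ m<n⇒m%n≡m b<N ⟩
    b               ∎
    where open ≡-Reasoning

  Step⇒multiple : ∀ {d u v} → Step N d u v → ∃[ k ] toℕ u + d ≡ toℕ v + k * N
  Step⇒multiple {v = v} (inj₁ e) = 0 , trans e (sym (+-identityʳ (toℕ v)))
  Step⇒multiple {v = v} (inj₂ e) = 1 , trans e (cong (toℕ v +_) (sym (*-identityˡ N)))

  multiple⇒Step : ∀ {d u v} k → k ≤ 1 → toℕ u + d ≡ toℕ v + k * N → Step N d u v
  multiple⇒Step {v = v} zero       _ e = inj₁ (trans e (+-identityʳ (toℕ v)))
  multiple⇒Step {v = v} (suc zero) _ e = inj₂ (trans e (cong (toℕ v +_) (*-identityˡ N)))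
  multiple⇒Step (suc (suc _)) (s≤s ())

  Step-functionalʳ : ∀ {d u v w} → Step N d u v → Step N d u w → v ≡ w
  Step-functionalʳ {d} {u} {v} {w} s t with Step⇒multiple {d} {u} {v} s | Step⇒multiple {d} {u} {w} t
  ... | k , e | l , f = toℕ-injective (remainder-unique k l (toℕ<n v) (toℕ<n w) (trans (sym e) f))

  Step-functionalˡ : ∀ {d u v w} → Step N d u v → Step N d w v → u ≡ w
  Step-functionalˡ {d} {u} {v} {w} s t with Step⇒multiple {d} {u} {v} s | Step⇒multiple {d} {w} {v} t
  ... | k , e | l , f = toℕ-injective (remainder-unique l k (toℕ<n u) (toℕ<n w) (+-cancelʳ-≡ d _ _ shifted))
    where
    open ≡-Reasoning
    shifted : toℕ u + l * N + d ≡ toℕ w + k * N + d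
    shifted = begin
      toℕ u + l * N + d     ≡⟨ xy∙z≈xz∙y (toℕ u) (l * N) d ⟩
      toℕ u + d + l * N     ≡⟨ cong (_+ l * N) e ⟩
      toℕ v + k * N + l * N ≡⟨ xy∙z≈xz∙y (toℕ v) (k * N) (l * N) ⟩
      toℕ v + l * N + k * N ≡⟨ cong (_+ k * N) f ⟨
      toℕ w + d + k * N     ≡⟨ xy∙z≈xz∙y (toℕ w) d (k * N) ⟩
      toℕ w + k * N + d     ∎

  Step-irreflexive : ∀ {d u} → 0 < d → d < N → ¬ Step N d u u
  Step-irreflexive {d} {u} 0<d d<N (inj₁ e) =
    <-irrefl (sym (+-cancelˡ-≡ (toℕ u) d 0 (trans e (sym (+-identityʳ (toℕ u)))))) 0<d
  Step-irreflexive {d} {u} 0<d d<N (inj₂ e) = <-irrefl (+-cancelˡ-≡ (toℕ u) d N e) d<N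

  Step-mod : ∀ {d} x → d ≤ N → Step N d (x mod N) ((d + x) mod N)
  Step-mod {d} x d≤N = multiple⇒Step {d} {x mod N} {(d + x) mod N} (a / N) quotient≤1 (begin
    toℕ (x mod N) + d             ≡⟨ cong (_+ d) (toℕ-mod x) ⟩
    a                             ≡⟨ m≡m%n+[m/n]*n a N ⟩
    a % N + a / N * N             ≡⟨ cong (_+ a / N * N) ([m%n+d]%n≡[d+m]%n x d) ⟩
    (d + x) % N + a / N * N       ≡⟨ cong (_+ a / N * N) (toℕ-mod (d + x)) ⟨
    toℕ ((d + x) mod N) + a / N * N ∎)
    where
    open ≡-Reasoning
    a = x % N + d
    a<2N : a < 2 * N
    a<2N = subst (a <_) (cong (N +_) (sym (+-identityʳ N))) (+-mono-<-≤ (m%n<n x N) d≤N)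
    quotient≤1 : a / N ≤ 1
    quotient≤1 = s≤s⁻¹ (m<n*o⇒m/o<n a<2N)

  mod-shift-≢ : ∀ {c} x → 0 < c → c < N → x mod N ≢ (c + x) mod N
  mod-shift-≢ {c} x 0<c c<N eq =
    Step-irreflexive 0<c c<N (subst (Step N c (x mod N)) (sym eq) (Step-mod x (<⇒≤ c<N)))

  mod-cover-+2 : ∀ (u : Fin N) a → ∃[ q ] (u ≡ (q * 2 + a) mod N ⊎ u ≡ (1 + (q * 2 + a)) mod N)
  mod-cover-+2 u a = m′ / 2 , byRemainder (m′ % 2) (m%n<n m′ 2) (begin
      u                               ≡⟨ toℕ-mod-inverse u ⟨
      toℕ u mod N                     ≡⟨ mod-periodic (toℕ u) a ⟨
      m mod N                         ≡⟨ cong (_mod N) (m∸n+n≡m a≤m) ⟨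
      (m′ + a) mod N                  ≡⟨ cong (λ t → (t + a) mod N) (m≡m%n+[m/n]*n m′ 2) ⟩
      (m′ % 2 + m′ / 2 * 2 + a) mod N ≡⟨ cong (_mod N) (+-assoc (m′ % 2) (m′ / 2 * 2) a) ⟩
      (m′ % 2 + (m′ / 2 * 2 + a)) mod N ∎)
    where
    open ≡-Reasoning
    m = toℕ u + a * N
    m′ = m ∸ a
    a≤m : a ≤ m
    a≤m = ≤-trans (m≤m*n a N) (m≤n+m (a * N) (toℕ u))
    byRemainder : ∀ r → r < 2 → u ≡ (r + (m′ / 2 * 2 + a)) mod N →
                  u ≡ (m′ / 2 * 2 + a) mod N ⊎ u ≡ (1 + (m′ / 2 * 2 + a)) mod N
    byRemainder zero          _ e = inj₁ e
    byRemainder (suc zero)    _ e = inj₂ e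
    byRemainder (suc (suc _)) (s≤s (s≤s ()))

module _ {N : ℕ} {G H : Graph N} (H-oneFactor : IsOneFactor G H) where

  oneFactor-sym : ∀ {u v} → H u v → H v u
  oneFactor-sym = let (H-sym , _ , _) = H-oneFactor in H-sym _ _

  oneFactor-⊆ : ∀ {u v} → H u v → G u v
  oneFactor-⊆ = let (_ , H⊆G , _) = H-oneFactor in H⊆G _ _

  oneFactor-mate : ∀ u → ∃[ v ] H u v
  oneFactor-mate u = let (_ , _ , regular) = H-oneFactor ; (v , h , _) = regular u in v , h

  oneFactor-unique : ∀ {u v w} → H u v → H u w → v ≡ w
  oneFactor-unique {u} h h′ =
    let (_ , _ , regular) = H-oneFactor ; (_ , _ , unique) = regular u
    in trans (unique _ h) (sym (unique _ h′))

factorisation-unique : ∀ {N} {G : Graph N} (F : OneFactorisation G) → let open OneFactorisation F in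
                       ∀ {u v i j} → G u v → factor i u v → factor j u v → i ≡ j
factorisation-unique F {u} {v} g h h′ =
  let (_ , _ , unique) = OneFactorisation.partition F u v g
  in trans (unique _ h) (sym (unique _ h′))

module _ {N : ℕ} (4<N : 4 < N) where

  1≤N : 1 ≤ N
  1≤N = ≤-trans (s≤s z≤n) 4<N

  private instance
    N-nonZero : NonZero N
    N-nonZero = >-nonZero 1≤N

  ⟦_⟧ : ℕ → Fin N
  ⟦ x ⟧ = x mod N

  2≤N : 2 ≤ N
  2≤N = ≤-trans (s≤s (s≤s z≤n)) 4<N

  oneEdge : ∀ x → Circ N D12 ⟦ x ⟧ ⟦ 1 + x ⟧
  oneEdge x = 1 , inj₁ refl , inj₁ (Step-mod x 1≤N)

  twoEdge : ∀ x → Circ N D12 ⟦ x ⟧ ⟦ 2 + x ⟧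
  twoEdge x = 2 , inj₂ refl , inj₁ (Step-mod x 2≤N)

  oneEdge-isOneEdge : ∀ x → IsOneEdge N ⟦ x ⟧ ⟦ 1 + x ⟧
  oneEdge-isOneEdge x = inj₁ (Step-mod x 1≤N)

  circ-neighbours : ∀ y {w} → Circ N D12 ⟦ 2 + y ⟧ w →
                    w ≡ ⟦ y ⟧ ⊎ w ≡ ⟦ 1 + y ⟧ ⊎ w ≡ ⟦ 3 + y ⟧ ⊎ w ≡ ⟦ 4 + y ⟧
  circ-neighbours y {w} (.1 , inj₁ refl , inj₁ s) =
    inj₂ (inj₂ (inj₁ (Step-functionalʳ {d = 1} {⟦ 2 + y ⟧} {w} s (Step-mod (2 + y) 1≤N))))
  circ-neighbours y {w} (.1 , inj₁ refl , inj₂ s) =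
    inj₂ (inj₁ (Step-functionalˡ {d = 1} {w} {⟦ 2 + y ⟧} s (Step-mod (1 + y) 1≤N)))
  circ-neighbours y {w} (.2 , inj₂ refl , inj₁ s) =
    inj₂ (inj₂ (inj₂ (Step-functionalʳ {d = 2} {⟦ 2 + y ⟧} {w} s (Step-mod (2 + y) 2≤N))))
  circ-neighbours y {w} (.2 , inj₂ refl , inj₂ s) =
    inj₁ (Step-functionalˡ {d = 2} {w} {⟦ 2 + y ⟧} s (Step-mod y 2≤N))

  module _ (F : OneFactorisation (Circ N D12)) where
    open OneFactorisation F

    factor-sym : ∀ {i u v} → factor i u v → factor i v u
    factor-sym {i} = oneFactor-sym (isFactor i)

    two-mates : ∀ {i u x} c → .{{NonZero c}} → c ≤ 4 → factor i u ⟦ x ⟧ → factor i u ⟦ c + x ⟧ → ⊥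
    two-mates {i} {x = x} c c≤4 h h′ =
      mod-shift-≢ x (>-nonZero⁻¹ c) (≤-<-trans c≤4 4<N) (oneFactor-unique (isFactor i) h h′)

    factor-mate-cases : ∀ i y → factor i ⟦ 2 + y ⟧ ⟦ y ⟧ ⊎ factor i ⟦ 2 + y ⟧ ⟦ 1 + y ⟧ ⊎
                                factor i ⟦ 2 + y ⟧ ⟦ 3 + y ⟧ ⊎ factor i ⟦ 2 + y ⟧ ⟦ 4 + y ⟧
    factor-mate-cases i y with oneFactor-mate (isFactor i) ⟦ 2 + y ⟧
    ... | w , h with circ-neighbours y (oneFactor-⊆ (isFactor i) h)
    ... | inj₁ refl               = inj₁ h
    ... | inj₂ (inj₁ refl)        = inj₂ (inj₁ h)
    ... | inj₂ (inj₂ (inj₁ refl)) = inj₂ (inj₂ (inj₁ h))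
    ... | inj₂ (inj₂ (inj₂ refl)) = inj₂ (inj₂ (inj₂ h))

    ParallelPair : ℕ → Set
    ParallelPair s = ∃[ f ] factor f ⟦ s ⟧ ⟦ 2 + s ⟧ × factor f ⟦ 1 + s ⟧ ⟦ 3 + s ⟧

    twoEdge-partner : ∀ {g} s → factor g ⟦ 1 + s ⟧ ⟦ 3 + s ⟧ →
                      factor g ⟦ s ⟧ ⟦ 2 + s ⟧ ⊎ factor g ⟦ 2 + s ⟧ ⟦ 4 + s ⟧
    twoEdge-partner {g} s h with factor-mate-cases g s
    ... | inj₁ h′               = inj₁ (factor-sym h′)
    ... | inj₂ (inj₁ h′)        = ⊥-elim (two-mates 1 (m≤m+n 1 3) (factor-sym h′) h)
    ... | inj₂ (inj₂ (inj₁ h′)) = ⊥-elim (two-mates 1 (m≤m+n 1 3) (factor-sym h) (factor-sym h′))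
    ... | inj₂ (inj₂ (inj₂ h′)) = inj₂ h′

    parallelPair-exists : ∃[ s ] ParallelPair s
    parallelPair-exists with partition ⟦ 1 ⟧ ⟦ 3 ⟧ (twoEdge 1)
    ... | g , h , _ with twoEdge-partner 0 h
    ... | inj₁ h′ = 0 , g , h′ , h
    ... | inj₂ h′ = 1 , g , h , h′

    parallelPair-step : ∀ {s} → ParallelPair s → ParallelPair (2 + s)
    parallelPair-step {s} (f , h₀ , h₁) with partition ⟦ 2 + s ⟧ ⟦ 4 + s ⟧ (twoEdge (2 + s))
    ... | g , h₂ , _ with twoEdge-partner (1 + s) h₂
    ... | inj₂ h₃ = g , h₂ , h₃
    ... | inj₁ h₁′ with factorisation-unique F (twoEdge (1 + s)) h₁ h₁′
    ... | refl = ⊥-elim (two-mates 4 ≤-refl (factor-sym h₀) h₂)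

    oneEdge-step : ∀ {j a} → factor j ⟦ a ⟧ ⟦ 1 + a ⟧ → ParallelPair (1 + a) → factor j ⟦ 2 + a ⟧ ⟦ 3 + a ⟧
    oneEdge-step {j} {a} h (f , h₁ , h₂) with factor-mate-cases j a
    ... | inj₁ h′               = ⊥-elim (two-mates 1 (m≤m+n 1 3) h (factor-sym h′))
    ... | inj₂ (inj₁ h′)        = ⊥-elim (two-mates 2 (m≤m+n 2 2) (factor-sym h) (factor-sym h′))
    ... | inj₂ (inj₂ (inj₁ h′)) = h′
    ... | inj₂ (inj₂ (inj₂ h′)) with factorisation-unique F (twoEdge (2 + a)) h′ h₂
    ... | refl = ⊥-elim (two-mates 3 (m≤m+n 3 1) (factor-sym h) h₁)

    only-oneEdges : ∀ {j} → (∀ u → ∃[ a ] factor j ⟦ a ⟧ ⟦ 1 + a ⟧ × (u ≡ ⟦ a ⟧ ⊎ u ≡ ⟦ 1 + a ⟧)) →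
                    ∀ u v → factor j u v → IsOneEdge N u v
    only-oneEdges {j} cover u v h with cover u
    ... | a , h′ , inj₁ refl =
      subst (IsOneEdge N u) (oneFactor-unique (isFactor j) h′ h) (oneEdge-isOneEdge a)
    ... | a , h′ , inj₂ refl =
      subst (IsOneEdge N u) (oneFactor-unique (isFactor j) (factor-sym h′) h) (swap (oneEdge-isOneEdge a))

    oneEdge-factor-exists : ∃[ i ] ∀ u v → factor i u v → IsOneEdge N u v
    oneEdge-factor-exists with parallelPair-exists
    ... | s , P with partition ⟦ 1 + s ⟧ ⟦ 2 + s ⟧ (oneEdge (1 + s))
    ... | j , h , _ = j , only-oneEdges cover
      where
      Invariant : ℕ → Set
      Invariant a = factor j ⟦ a ⟧ ⟦ 1 + a ⟧ × ParallelPair (1 + a)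

      invariant : ∀ q → Invariant (q * 2 + (1 + s))
      invariant = iterate-+2 Invariant (λ (h , P) → oneEdge-step h P , parallelPair-step P)
                             (h , parallelPair-step P)

      cover : ∀ u → ∃[ a ] factor j ⟦ a ⟧ ⟦ 1 + a ⟧ × (u ≡ ⟦ a ⟧ ⊎ u ≡ ⟦ 1 + a ⟧)
      cover u = let (q , e) = mod-cover-+2 u (1 + s) ; (h , _) = invariant q in q * 2 + (1 + s) , h , e

mainTheorem17 : (n : ℕ) → 3 ≤ n → 2 ∣ n →
    (F : OneFactorisation (Circ (2 * n) D12)) →
    Σ (Fin (OneFactorisation.k F)) λ i →
      ∀ u v → OneFactorisation.factor F i u v → IsOneEdge (2 * n) u v
mainTheorem17 n 3≤n _ = oneEdge-factor-exists (≤-trans (n≤1+n 5) (*-monoʳ-≤ 2 3≤n))
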